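{- Let $S$ be a string of length $n$ ending with the unique end symbol $\$$, let $k\in[1,n-1]$, and let $\phi$ be a node of the rotation-trie $\mathcal{T}(S)$ at level $k$. Let $(\phi,\varphi,c)$ be a Weiner link of $\phi$ and let $\psi$ be the parent of $\varphi$ in $\mathcal{T}(S)$; put $x=l(\psi)$ and $y=l(\phi)$. Then the following are equivalent: (i) $(\phi,\varphi,c)$ is a unique Weiner link of $\phi$ and $\varphi$ has no siblings in $\mathcal{T}(S)$; (ii) in the de Bruijn graph $G_k(S)$, $x$ is the only predecessor of $y$ and $y$ is the only successor of $x$.
   Context: $\Sigma$ is a finite totally ordered alphabet containing a symbol $\$$ smaller than all other symbols; $S$ is a string of length $n$ over $\Sigma$ whose last character is $\$$ and in which $\$$ occurs nowhere else; indices start at $1$. De Bruijn graph: for $k\in[1,n]$ let $Z_k(S)=S[1..n]S[1..k]$ and $\mathcal{K}=\{Z_k(S)[i..i+k-1]\mid i\in[1,n]\}$. $G_k(S)=(\mathcal{K},E)$ is the directed multigraph with edge multiset $E=\{(x[1..k],x[2..k+1])^m \mid x\in\Sigma^{k+1}\text{ occurs exactly } m\geq1 \text{ times in } Z_k(S)\}$ ($m$ = multiplicity). A predecessor of $y$ is a node $x$ with an edge $(x,y)^m\in E$; a successor of $x$ is a node $y$ with such an edge. Rotation-trie: $\mathcal{T}(S)$ is the trie of the $n$ (distinct) rotations $S[i..n]S[1..i-1]$ of $S$, with children ordered by lexicographic order of labels; $l(\phi)$ is the concatenation of the edge labels from the root to $\phi$, and the level of $\phi$ is $|l(\phi)|$.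 Weiner links: $(\phi,\varphi,c)$, with $c\in\Sigma$, is a Weiner link of $\phi$ if $l(\varphi)=c\,l(\phi)$, or $|l(\phi)|=n$ and $l(\varphi)=c\,l(\phi)[1..n-1]$. A Weiner link $(\phi,\varphi,c)$ is unique if there is no other Weiner link $(\phi,\psi,d)$ of $\phi$ with $\psi\neq\varphi$. -}

module Defs where

open import Data.Nat using (ℕ; zero; suc; _+_; _∸_; _<_; _≤_)
open import Data.Fin using (Fin)
import Data.Fin
open import Data.List using (List; []; _∷_; _++_; [_]; take; drop; length)
open import Data.List.Membership.Propositional using (_∈_)
open import Data.Product using (Σ; ∃; _×_; ∃-syntax)
open import Data.Sum using (_⊎_)
open import Relation.Binary.PropositionalEquality using (_≡_)
open import Relation.Nullary using (¬_)

-- Alphabet Σ = Fin (suc σ), ordered as Fin; the end symbol $ is `zero`,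
-- which is smaller than every other symbol.
Sym : ℕ → Set
Sym σ = Fin (suc σ)

Str : ℕ → Set
Str σ = List (Sym σ)

$ : ∀ {σ} → Sym σ
$ = Data.Fin.zero

EndMarked : ∀ {σ} → Str σ → Set
EndMarked {σ} S = Σ (Str σ) λ T → (S ≡ T ++ [ $ ]) × ¬ ($ ∈ T)

-- Rotations and the rotation-trie (0-indexed: rotation i = S[i+1..n]S[1..i])

rot : ∀ {σ} → Str σ → ℕ → Str σ
rot S i = drop i S ++ take i S

-- Nodes of T(S) are identified with their labels l(φ): exactly the
-- prefixes (of any length 0..n) of the rotations of S.
IsNode : ∀ {σ} → Str σ → Str σ → Set
IsNode {σ} S w = ∃[ i ] (i < length S × Σ (Str σ) λ r → w ++ r ≡ rot S i)

Parent : ∀ {σ} → Str σ → Str σ → Str σ → Set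
Parent S p v = IsNode S p × IsNode S v × ∃[ a ] (v ≡ p ++ [ a ])

NoSiblings : ∀ {σ} → Str σ → Str σ → Set
NoSiblings {σ} S v = (p v' : Str σ) → Parent S p v → Parent S p v' → v' ≡ v

-- Weiner link (φ, ϕ, c) with l(φ) = y, l(ϕ) = v
WeinerLink : ∀ {σ} → Str σ → Str σ → Str σ → Sym σ → Set
WeinerLink S y v c =
  IsNode S y × IsNode S v ×
  ((v ≡ c ∷ y) ⊎ ((length y ≡ length S) × (v ≡ c ∷ take (length S ∸ 1) y)))

UniqueWeinerLink : ∀ {σ} → Str σ → Str σ → Str σ → Sym σ → Set
UniqueWeinerLink {σ} S y v c =
  WeinerLink S y v c × ((v' : Str σ) (d : Sym σ) → WeinerLink S y v' d → v' ≡ v)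

Z : ∀ {σ} → ℕ → Str σ → Str σ
Z k S = S ++ take k S

InK : ∀ {σ} → ℕ → Str σ → Str σ → Set
InK k S w = ∃[ i ] (i < length S × take k (drop i (Z k S)) ≡ w)

OccursEdge : ∀ {σ} → ℕ → Str σ → Str σ → Set
OccursEdge k S u =
  length u ≡ suc k × ∃[ i ] (i + suc k ≤ length (Z k S) × take (suc k) (drop i (Z k S)) ≡ u)

-- there is an edge (x, y)^m with m ≥ 1 in G_k(S)
Edge : ∀ {σ} → ℕ → Str σ → Str σ → Str σ → Set
Edge {σ} k S x y =
  InK k S x × InK k S y ×
  Σ (Str σ) λ u → OccursEdge k S u × take k u ≡ x × drop 1 u ≡ y

OnlyPredecessor : ∀ {σ} → ℕ → Str σ → Str σ → Str σ → Set
OnlyPredecessor {σ} k S x y = Edge k S x y × ((x' : Str σ) → Edge k S x' y → x' ≡ x)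

OnlySuccessor : ∀ {σ} → ℕ → Str σ → Str σ → Str σ → Set
OnlySuccessor {σ} k S x y = Edge k S x y × ((y' : Str σ) → Edge k S x y' → y' ≡ y)

module Submission where

-- Fix k < n.  A string of length at most k+1 is a node of T(S) iff it is
-- a window of Z_k(S) = S S[1..k] starting at a position i < n, because the
-- window at i agrees with the rotation starting at i on its first k+1
-- characters.  Consequently the level-k nodes of T(S) are vertices of
-- G_k(S), and the level-(k+1) nodes u of T(S) are exactly the edge strings
-- of G_k(S), u being an edge from its prefix  take k u  to its tail
-- drop 1 u  (both of which are nodes again, as T(S) is closed under taking
-- prefixes and under dropping the first character).
--
-- Let v = c y be the child of x = l(ψ) through the Weiner link.  Since a
-- string of length k+1 (k ≥ 1) is determined by its prefix and its tail,
--   * the Weiner link is unique  iff  v is the only level-(k+1) node with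
--     tail y  iff  x is the only predecessor of y, and
--   * v has no siblings  iff  v is the only level-(k+1) node with prefix x
--     iff  y is the only successor of x.
-- The theorem is the product of these two chains of equivalences.

open import Defs
open import Data.Nat using (ℕ; zero; suc; _+_; _∸_; _⊓_; _≤_; _<_; z≤n; s≤s)
open import Data.Nat.Properties
  using ( suc-injective; ≤-refl; ≤-trans; <⇒≤; n≤1+n; <-irrefl; +-suc; +-monoˡ-≤; +-cancelʳ-≤
        ; m≤n⇒m⊓n≡m; m∸n+n≡m; m<n⇒0<n∸m; m≤n+o⇒m∸n≤o )
open import Data.List using (List; []; _∷_; _++_; [_]; take; drop; length)
open import Data.List.Properties
  using ( length-++; length-take; length-drop; take-take
        ; take++drop≡id; ++-assoc; ++-identityʳ; ∷-injectiveˡ; ∷-injectiveʳ; ∷ʳ-injectiveˡ )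
open import Data.Product using (∃; _×_; _,_)
open import Data.Product.Function.NonDependent.Propositional using (_×-⇔_)
open import Data.Sum using (inj₁; inj₂)
open import Data.Empty using (⊥-elim)
open import Function.Bundles using (_⇔_; mk⇔)
import Function.Properties.Equivalence as ⇔
open import Relation.Binary.PropositionalEquality
  using (_≡_; refl; sym; trans; cong; cong₂; subst; subst₂; module ≡-Reasoning)

module _ {A : Set} where

  take-++ : ∀ m (xs ys : List A) →
            take m (xs ++ ys) ≡ take m xs ++ take (m ∸ length xs) ys
  take-++ zero    []       ys = refl
  take-++ zero    (x ∷ xs) ys = refl
  take-++ (suc m) []       ys = refl
  take-++ (suc m) (x ∷ xs) ys = cong (x ∷_) (take-++ m xs ys)

  drop-++-≤ : ∀ i (xs ys : List A) → i ≤ length xs →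
              drop i (xs ++ ys) ≡ drop i xs ++ ys
  drop-++-≤ zero    xs       ys _         = refl
  drop-++-≤ (suc i) (x ∷ xs) ys (s≤s i≤n) = drop-++-≤ i xs ys i≤n

  take-++-exact : ∀ {m} (xs ys : List A) → length xs ≡ m → take m (xs ++ ys) ≡ xs
  take-++-exact []       ys refl = refl
  take-++-exact (x ∷ xs) ys refl = cong (x ∷_) (take-++-exact xs ys refl)

  length-snoc : ∀ (xs : List A) {a} → length (xs ++ [ a ]) ≡ suc (length xs)
  length-snoc []       = refl
  length-snoc (x ∷ xs) = cong suc (length-snoc xs)

  take-take-≤ : ∀ {m n} (xs : List A) → m ≤ n → take m (take n xs) ≡ take m xs
  take-take-≤ {m} {n} xs m≤n =
    trans (take-take m n xs) (cong (λ j → take j xs) (m≤n⇒m⊓n≡m m≤n))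

  drop-∷⇒< : ∀ i (xs : List A) {a ds} → drop i xs ≡ a ∷ ds → i < length xs
  drop-∷⇒< zero    (x ∷ xs) _ = s≤s z≤n
  drop-∷⇒< (suc i) (x ∷ xs) e = s≤s (drop-∷⇒< i xs e)

  <⇒drop-∷ : ∀ i (xs : List A) → i < length xs → ∃ λ a → ∃ λ ds → drop i xs ≡ a ∷ ds
  <⇒drop-∷ zero    (x ∷ xs) _         = x , xs , refl
  <⇒drop-∷ (suc i) (x ∷ xs) (s≤s i<n) = <⇒drop-∷ i xs i<n

  take-suc : ∀ i (xs : List A) {a ds} → drop i xs ≡ a ∷ ds →
             take (suc i) xs ≡ take i xs ++ [ a ]
  take-suc zero    (x ∷ xs) refl = refl
  take-suc (suc i) (x ∷ xs) e    = cong (x ∷_) (take-suc i xs e)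

  drop-suc : ∀ i (xs : List A) {a ds} → drop i xs ≡ a ∷ ds → drop (suc i) xs ≡ ds
  drop-suc zero    (x ∷ xs) refl = refl
  drop-suc (suc i) (x ∷ xs) e    = drop-suc i xs e

  snoc-view : ∀ k (u : List A) → length u ≡ suc k → ∃ λ a → u ≡ take k u ++ [ a ]
  snoc-view zero    (a ∷ [])    refl = a , refl
  snoc-view (suc k) (b ∷ u)     lu   with snoc-view k u (suc-injective lu)
  ... | a , u≡ = a , cong (b ∷_) u≡

  cons-view : ∀ (u ys : List A) → 1 ≤ length u → drop 1 u ≡ ys → ∃ λ a → u ≡ a ∷ ys
  cons-view (a ∷ u) ys _ refl = a , refl

  prefix-tail-injective : ∀ k → 1 ≤ k → (u u' : List A) →
                          take k u ≡ take k u' → drop 1 u ≡ drop 1 u' → u ≡ u'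
  prefix-tail-injective (suc k) _ []      []        _  _  = refl
  prefix-tail-injective (suc k) _ (a ∷ u) (a' ∷ u') pu tu = cong₂ _∷_ (∷-injectiveˡ pu) tu

module _ {σ : ℕ} (S : Str σ) where

  node-prefix : ∀ m {w} → IsNode S w → IsNode S (take m w)
  node-prefix m {w} (i , i<n , r , w++r≡rot) = i , i<n , drop m w ++ r , prefix
    where
    open ≡-Reasoning
    prefix : take m w ++ (drop m w ++ r) ≡ rot S i
    prefix = begin
      take m w ++ (drop m w ++ r) ≡⟨ sym (++-assoc (take m w) (drop m w) r) ⟩
      (take m w ++ drop m w) ++ r ≡⟨ cong (_++ r) (take++drop≡id m w) ⟩
      w ++ r                      ≡⟨ w++r≡rot ⟩
      rot S i                     ∎

  rot-step : ∀ i → i < length S →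
             ∃ λ j → j < length S × ∃ λ a → ∃ λ t → rot S i ≡ a ∷ t × rot S j ≡ t ++ [ a ]
  rot-step i i<n with <⇒drop-∷ i S i<n
  ... | a , []     , drop-i =
    0 , ≤-trans (s≤s z≤n) i<n , a , take i S , cong (_++ take i S) drop-i , wrap-around
    where
    open ≡-Reasoning
    -- the last rotation shifts back to S itself
    wrap-around : S ++ [] ≡ take i S ++ [ a ]
    wrap-around = begin
      S ++ []                           ≡⟨ ++-identityʳ S ⟩
      S                                 ≡⟨ sym (take++drop≡id (suc i) S) ⟩
      take (suc i) S ++ drop (suc i) S  ≡⟨ cong (take (suc i) S ++_) (drop-suc i S drop-i) ⟩
      take (suc i) S ++ []              ≡⟨ ++-identityʳ (take (suc i) S) ⟩
      take (suc i) S                    ≡⟨ take-suc i S drop-i ⟩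
      take i S ++ [ a ]                 ∎
  ... | a , b ∷ ds , drop-i =
    suc i , drop-∷⇒< (suc i) S (drop-suc i S drop-i) , a , b ∷ ds ++ take i S ,
    cong (_++ take i S) drop-i ,
    trans (cong₂ _++_ (drop-suc i S drop-i) (take-suc i S drop-i))
          (sym (++-assoc (b ∷ ds) (take i S) [ a ]))

  node-tail : ∀ {w} → IsNode S w → IsNode S (drop 1 w)
  node-tail {[]}    nw = nw
  node-tail {b ∷ w} (i , i<n , r , b∷w++r≡rot) with rot-step i i<n
  ... | j , j<n , a , t , rot-i , rot-j = j , j<n , r ++ [ a ] , tail-prefix
    where
    open ≡-Reasoning
    tail-prefix : w ++ r ++ [ a ] ≡ rot S j
    tail-prefix = begin
      w ++ r ++ [ a ]   ≡⟨ sym (++-assoc w r [ a ]) ⟩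
      (w ++ r) ++ [ a ] ≡⟨ cong (_++ [ a ]) (∷-injectiveʳ (trans b∷w++r≡rot rot-i)) ⟩
      t ++ [ a ]        ≡⟨ sym rot-j ⟩
      rot S j           ∎

weinerLink-prepends : ∀ {σ} {S : Str σ} {y v c} → length y < length S →
                      WeinerLink S y v c → v ≡ c ∷ y
weinerLink-prepends _   (_ , _ , inj₁ v≡cy)      = v≡cy
weinerLink-prepends y<n (_ , _ , inj₂ (y≡n , _)) = ⊥-elim (<-irrefl y≡n y<n)

module Order {σ : ℕ} (S : Str σ) (k : ℕ) (k<n : k < length S) where

  window≡rot-prefix : ∀ i m → i < length S → m ≤ suc k → m ≤ length S →
                      take m (drop i (Z k S)) ≡ take m (rot S i)
  window≡rot-prefix i m i<n m≤k+1 m≤n = begin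
    take m (drop i (S ++ take k S))        ≡⟨ cong (take m) (drop-++-≤ i S (take k S) (<⇒≤ i<n)) ⟩
    take m (drop i S ++ take k S)          ≡⟨ take-++ m (drop i S) (take k S) ⟩
    take m (drop i S) ++ take j (take k S) ≡⟨ cong (take m (drop i S) ++_) first-j ⟩
    take m (drop i S) ++ take j (take i S) ≡⟨ sym (take-++ m (drop i S) (take i S)) ⟩
    take m (rot S i)                       ∎
    where
    open ≡-Reasoning
    -- d characters remain after position i; the window needs j more
    d = length (drop i S)
    j = m ∸ d
    d+i≡n : d + i ≡ length S
    d+i≡n = trans (cong (_+ i) (length-drop i S)) (m∸n+n≡m (<⇒≤ i<n))
    1≤d : 1 ≤ d
    1≤d = subst (1 ≤_) (sym (length-drop i S)) (m<n⇒0<n∸m i<n)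
    j≤k : j ≤ k
    j≤k = m≤n+o⇒m∸n≤o m d (≤-trans m≤k+1 (+-monoˡ-≤ k 1≤d))
    j≤i : j ≤ i
    j≤i = m≤n+o⇒m∸n≤o m d (subst (m ≤_) (sym d+i≡n) m≤n)
    -- both tails are the first j characters of S
    first-j : take j (take k S) ≡ take j (take i S)
    first-j = trans (take-take-≤ S j≤k) (sym (take-take-≤ S j≤i))

  length-Z : length (Z k S) ≡ length S + k
  length-Z = trans (length-++ S)
                   (cong (length S +_) (trans (length-take k S) (m≤n⇒m⊓n≡m (<⇒≤ k<n))))

  node⇒window : ∀ {w} → IsNode S w → length w ≤ suc k →
                ∃ λ i → i < length S × take (length w) (drop i (Z k S)) ≡ w
  node⇒window {w} (i , i<n , r , w++r≡rot) lw≤k+1 =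
    i , i<n , trans (window≡rot-prefix i (length w) i<n lw≤k+1 (≤-trans lw≤k+1 k<n))
                    (trans (cong (take (length w)) (sym w++r≡rot)) (take-++-exact w r refl))

  node⇒vertex : ∀ {w} → IsNode S w → length w ≡ k → InK k S w
  node⇒vertex {w} nw lw with node⇒window nw (subst (_≤ suc k) (sym lw) (n≤1+n k))
  ... | i , i<n , window = i , i<n , subst (λ m → take m (drop i (Z k S)) ≡ w) lw window

  node⇒edgeString : ∀ {w} → IsNode S w → length w ≡ suc k → OccursEdge k S w
  node⇒edgeString {w} nw lw with node⇒window nw (subst (_≤ suc k) (sym lw) ≤-refl)
  ... | i , i<n , window =
    lw , i , subst₂ _≤_ (sym (+-suc i k)) (sym length-Z) (+-monoˡ-≤ k i<n) ,
    subst (λ m → take m (drop i (Z k S)) ≡ w) lw window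

  edgeString⇒node : ∀ {u} → OccursEdge k S u → IsNode S u
  edgeString⇒node {u} (_ , i , fits , window) = i , i<n , drop (suc k) (rot S i) , prefix
    where
    i<n : i < length S
    i<n = +-cancelʳ-≤ k (suc i) (length S) (subst₂ _≤_ (+-suc i k) length-Z fits)
    prefix : u ++ drop (suc k) (rot S i) ≡ rot S i
    prefix = trans (cong (_++ drop (suc k) (rot S i))
                         (trans (sym window) (window≡rot-prefix i (suc k) i<n ≤-refl k<n)))
                   (take++drop≡id (suc k) (rot S i))

  node⇒edge : ∀ {u} → IsNode S u → length u ≡ suc k → Edge k S (take k u) (drop 1 u)
  node⇒edge {u} nu lu =
    node⇒vertex (node-prefix S k nu) length-prefix ,
    node⇒vertex (node-tail S nu) (trans (length-drop 1 u) (cong (_∸ 1) lu)) ,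
    u , node⇒edgeString nu lu , refl , refl
    where
    length-prefix : length (take k u) ≡ k
    length-prefix = trans (length-take k u) (trans (cong (k ⊓_) lu) (m≤n⇒m⊓n≡m (n≤1+n k)))

  edge⇒node : ∀ {x y} → Edge k S x y →
              ∃ λ u → IsNode S u × length u ≡ suc k × take k u ≡ x × drop 1 u ≡ y
  edge⇒node (_ , _ , u , occ@(lu , _) , ux , uy) = u , edgeString⇒node occ , lu , ux , uy

  OnlyNodeWithTail : Str σ → Str σ → Set
  OnlyNodeWithTail y v = ∀ u → IsNode S u → length u ≡ suc k → drop 1 u ≡ y → u ≡ v

  OnlyNodeWithPrefix : Str σ → Str σ → Set
  OnlyNodeWithPrefix x v = ∀ u → IsNode S u → length u ≡ suc k → take k u ≡ x → u ≡ v

  module _ (k≥1 : 1 ≤ k) {x y v : Str σ} (nv : IsNode S v) (lv : length v ≡ suc k)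
           (vx : take k v ≡ x) (vy : drop 1 v ≡ y) where

    edge-xy : Edge k S x y
    edge-xy = subst₂ (Edge k S) vx vy (node⇒edge nv lv)

    -- An edge into y is determined by its source, since k ≥ 1.
    onlyPredecessor⇔onlyNodeWithTail : OnlyPredecessor k S x y ⇔ OnlyNodeWithTail y v
    onlyPredecessor⇔onlyNodeWithTail = mk⇔ to from
      where
      to : OnlyPredecessor k S x y → OnlyNodeWithTail y v
      to (_ , only) u nu lu uy = prefix-tail-injective k k≥1 u v
        (trans (only (take k u) (subst (Edge k S (take k u)) uy (node⇒edge nu lu))) (sym vx))
        (trans uy (sym vy))
      from : OnlyNodeWithTail y v → OnlyPredecessor k S x y
      from only = edge-xy , predecessor≡x
        where
        predecessor≡x : ∀ x' → Edge k S x' y → x' ≡ x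
        predecessor≡x x' e with edge⇒node e
        ... | u , nu , lu , ux' , uy = trans (sym ux') (trans (cong (take k) (only u nu lu uy)) vx)

    -- An edge out of x is determined by its target, since k ≥ 1.
    onlySuccessor⇔onlyNodeWithPrefix : OnlySuccessor k S x y ⇔ OnlyNodeWithPrefix x v
    onlySuccessor⇔onlyNodeWithPrefix = mk⇔ to from
      where
      to : OnlySuccessor k S x y → OnlyNodeWithPrefix x v
      to (_ , only) u nu lu ux = prefix-tail-injective k k≥1 u v
        (trans ux (sym vx))
        (trans (only (drop 1 u) (subst (λ x' → Edge k S x' (drop 1 u)) ux (node⇒edge nu lu))) (sym vy))
      from : OnlyNodeWithPrefix x v → OnlySuccessor k S x y
      from only = edge-xy , successor≡y
        where
        successor≡y : ∀ y' → Edge k S x y' → y' ≡ y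
        successor≡y y' e with edge⇒node e
        ... | u , nu , lu , ux , uy' = trans (sym uy') (trans (cong (drop 1) (only u nu lu ux)) vy)

  -- The Weiner links of a level-k node y are its level-(k+1) nodes with tail y.
  uniqueWeinerLink⇔onlyNodeWithTail : ∀ {y v c} → length y ≡ k → WeinerLink S y v c →
                                      UniqueWeinerLink S y v c ⇔ OnlyNodeWithTail y v
  uniqueWeinerLink⇔onlyNodeWithTail {y} {v} {c} ly wl@(ny , _ , _) = mk⇔ to from
    where
    y<n : length y < length S
    y<n = subst (_< length S) (sym ly) k<n
    to : UniqueWeinerLink S y v c → OnlyNodeWithTail y v
    to (_ , unique) u nu lu uy with cons-view u y (subst (1 ≤_) (sym lu) (s≤s z≤n)) uy
    ... | d , u≡dy = unique u d (ny , nu , inj₁ u≡dy)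
    from : OnlyNodeWithTail y v → UniqueWeinerLink S y v c
    from only = wl , λ { v' d wl'@(_ , nv' , _) →
      let v'≡dy = weinerLink-prepends y<n wl' in
      only v' nv' (trans (cong length v'≡dy) (cong suc ly)) (cong (drop 1) v'≡dy) }

  -- The siblings of a child of a level-k node x are its level-(k+1) nodes with prefix x.
  noSiblings⇔onlyNodeWithPrefix : ∀ {x v} → length x ≡ k → Parent S x v →
                                  NoSiblings S v ⇔ OnlyNodeWithPrefix x v
  noSiblings⇔onlyNodeWithPrefix {x} {v} lx par@(nx , _ , a , v≡xa) = mk⇔ to from
    where
    to : NoSiblings S v → OnlyNodeWithPrefix x v
    to noSiblings u nu lu ux with snoc-view k u lu
    ... | a' , u≡ = noSiblings x u par (nx , nu , a' , trans u≡ (cong (_++ [ a' ]) ux))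
    from : OnlyNodeWithPrefix x v → NoSiblings S v
    from only p v' (_ , _ , b , v≡pb) (_ , nv' , b' , v'≡pb') =
      only v' nv' (trans (cong length v'≡xb') (trans (length-snoc x) (cong suc lx)))
                  (trans (cong (take k) v'≡xb') (take-++-exact x [ b' ] lx))
      where
      p≡x : p ≡ x
      p≡x = ∷ʳ-injectiveˡ p x (trans (sym v≡pb) v≡xa)
      v'≡xb' : v' ≡ x ++ [ b' ]
      v'≡xb' = trans v'≡pb' (cong (_++ [ b' ]) p≡x)

lemma2 : {σ : ℕ} (S : Str σ) → EndMarked S →
         (k : ℕ) → 1 ≤ k → suc k ≤ length S →
         (y : Str σ) → IsNode S y → length y ≡ k →
         (v : Str σ) (c : Sym σ) → WeinerLink S y v c →
         (x : Str σ) → Parent S x v →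
         ((UniqueWeinerLink S y v c × NoSiblings S v)
           ⇔ (OnlyPredecessor k S x y × OnlySuccessor k S x y))
lemma2 S _ k k≥1 k<n y ny ly v c wl x par@(_ , nv , a , v≡xa) =
  ⇔.trans (uniqueWeinerLink⇔onlyNodeWithTail ly wl)
          (⇔.sym (onlyPredecessor⇔onlyNodeWithTail k≥1 nv lv vx vy))
  ×-⇔
  ⇔.trans (noSiblings⇔onlyNodeWithPrefix lx par)
          (⇔.sym (onlySuccessor⇔onlyNodeWithPrefix k≥1 nv lv vx vy))
  where
  open Order S k k<n
  v≡cy : v ≡ c ∷ y
  v≡cy = weinerLink-prepends (subst (_< length S) (sym ly) k<n) wl
  lv : length v ≡ suc k
  lv = trans (cong length v≡cy) (cong suc ly)
  vy : drop 1 v ≡ y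
  vy = cong (drop 1) v≡cy
  lx : length x ≡ k
  lx = suc-injective (trans (sym (length-snoc x)) (trans (cong length (sym v≡xa)) lv))
  vx : take k v ≡ x
  vx = trans (cong (take k) v≡xa) (take-++-exact x [ a ] lx)
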